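{- The functor $\mathbf{Petri}\to\mathbf{PrSh}(\mathbf{elGr})$, $\mathsf P\mapsto\operatorname{Hom}(-,\mathsf P)$, is fully faithful.
   Context: A Petri net is a diagram of finite sets $S\leftarrow I\to T\leftarrow O\to S$; a morphism of such diagrams consists of maps on the four sets (same map on both copies of $S$) commuting with the structure maps, and is etale if the two middle squares are pullbacks. $\mathbf{Petri}$ is the category of Petri nets and etale maps. Graphs are such diagrams $A\leftarrow I_G\to N\leftarrow O_G\to A$ with injective outer maps, hence are Petri nets. $\mathbf{elGr}$ is the full subcategory of elementary graphs: the unit graph $1\leftarrow\emptyset\to\emptyset\leftarrow\emptyset\to1$ and corollas $m+n\leftarrow m\to1\leftarrow n\to m+n$, with etale maps. $\mathbf{PrSh}(\mathbf{elGr})$ is the category of presheaves $\mathbf{elGr}^{op}\to\mathbf{Set}$, and $\operatorname{Hom}(-,\mathsf P)$ is the restricted Yoneda functor $\mathsf E\mapsto\operatorname{Hom}_{\mathbf{Petri}}(\mathsf E,\mathsf P)$. -}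

module Defs where

open import Data.Nat using (ℕ; _+_)
open import Data.Fin using (Fin; _↑ˡ_; _↑ʳ_; zero)
open import Data.Product using (Σ; ∃; ∃!; _×_; _,_; proj₁; proj₂)
open import Relation.Binary.PropositionalEquality

record Petri : Set where
  field
    nS nI nT nO : ℕ
    iS : Fin nI → Fin nS
    iT : Fin nI → Fin nT
    oT : Fin nO → Fin nT
    oS : Fin nO → Fin nS

open Petri public

-- The square  I → T, I' → T'  (with fI, fT) is a pullback:
-- the comparison map I → T ×_{T'} I', i ↦ (iT i , fI i), is a bijection.
IsPullback : {I T I' T' : Set} (p : I → T) (fI : I → I') (fT : T → T') (p' : I' → T') → Set
IsPullback {I} {T} {I'} p fI fT p' =
  ∀ (t : T) (j : I') → p' j ≡ fT t → ∃! _≡_ (λ (i : I) → p i ≡ t × fI i ≡ j)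

record Hom (P Q : Petri) : Set where
  field
    fS : Fin (nS P) → Fin (nS Q)
    fI : Fin (nI P) → Fin (nI Q)
    fT : Fin (nT P) → Fin (nT Q)
    fO : Fin (nO P) → Fin (nO Q)
    comm-iS : ∀ i → fS (iS P i) ≡ iS Q (fI i)
    comm-iT : ∀ i → fT (iT P i) ≡ iT Q (fI i)
    comm-oT : ∀ o → fT (oT P o) ≡ oT Q (fO o)
    comm-oS : ∀ o → fS (oS P o) ≡ oS Q (fO o)
    pb-I : IsPullback (iT P) fI fT (iT Q)
    pb-O : IsPullback (oT P) fO fT (oT Q)

open Hom public

_≈H_ : {P Q : Petri} → Hom P Q → Hom P Q → Set
f ≈H g = (∀ x → fS f x ≡ fS g x) × (∀ x → fI f x ≡ fI g x)
       × (∀ x → fT f x ≡ fT g x) × (∀ x → fO f x ≡ fO g x)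

pb-∘ : {I T I' T' I'' T'' : Set}
  {p : I → T} {gI : I → I'} {gT : T → T'} {p' : I' → T'}
  {hI : I' → I''} {hT : T' → T''} {p'' : I'' → T''} →
  (∀ i → gT (p i) ≡ p' (gI i)) →
  IsPullback p gI gT p' → IsPullback p' hI hT p'' →
  IsPullback p (λ i → hI (gI i)) (λ t → hT (gT t)) p''
pb-∘ {p = p} {gI} {gT} {p'} {hI} com pg ph t k eq
  with ph (gT t) k eq
... | (j , (pj , hj) , uj) with pg t j pj
... | (i , (pi , gi) , ui) =
  i , (pi , trans (cong hI gi) hj) ,
  λ { {y} (py , hy) →
        let gy≡j = sym (uj {gI y} (trans (sym (com y)) (cong gT py) , hy))
        in ui (py , gy≡j) }

_∘H_ : {P Q R : Petri} → Hom Q R → Hom P Q → Hom P R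
_∘H_ {P} {Q} {R} h g = record
  { fS = λ x → fS h (fS g x)
  ; fI = λ x → fI h (fI g x)
  ; fT = λ x → fT h (fT g x)
  ; fO = λ x → fO h (fO g x)
  ; comm-iS = λ i → trans (cong (fS h) (comm-iS g i)) (comm-iS h (fI g i))
  ; comm-iT = λ i → trans (cong (fT h) (comm-iT g i)) (comm-iT h (fI g i))
  ; comm-oT = λ o → trans (cong (fT h) (comm-oT g o)) (comm-oT h (fO g o))
  ; comm-oS = λ o → trans (cong (fS h) (comm-oS g o)) (comm-oS h (fO g o))
  ; pb-I = pb-∘ (comm-iT g) (pb-I g) (pb-I h)
  ; pb-O = pb-∘ (comm-oT g) (pb-O g) (pb-O h)
  }

data ElGr : Set where
  unitG : ElGr
  corolla : ℕ → ℕ → ElGr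

el : ElGr → Petri
el unitG = record { nS = 1 ; nI = 0 ; nT = 0 ; nO = 0
                  ; iS = λ () ; iT = λ () ; oT = λ () ; oS = λ () }
el (corolla m n) = record { nS = m + n ; nI = m ; nT = 1 ; nO = n
                          ; iS = λ i → i ↑ˡ n ; iT = λ _ → zero
                          ; oT = λ _ → zero ; oS = λ o → m ↑ʳ o }

-- Morphisms of presheaves on elGr between Hom(-,P) and Hom(-,Q)
-- (Hom-sets are setoids under ≈H; components must respect ≈H).
record NatTrans (P Q : Petri) : Set where
  field
    α : (E : ElGr) → Hom (el E) P → Hom (el E) Q
    α-resp : ∀ E {f g : Hom (el E) P} → f ≈H g → α E f ≈H α E g
    natural : ∀ E E' (u : Hom (el E') (el E)) (f : Hom (el E) P) →
              α E' (f ∘H u) ≈H (α E f ∘H u)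

open NatTrans public

-- A Petri net P is recovered from maps of elementary graphs into it: a place s
-- is the point 1 → P picking s, and a transition t is its star, the corolla
-- C(m,n) → P enumerating the m inputs and n outputs of t. Every map out of
-- the unit graph is a point, and every map out of a corolla factors through
-- the star of the transition it hits. Hence a natural transformation
-- Hom(-,P) → Hom(-,Q) is determined by its values on points and stars, and
-- these values glue to an etale map P → Q; faithfulness is the same covering
-- argument applied to two maps.
module Submission where

open import Defs
open import Data.Nat using (ℕ; zero; suc; _+_)
open import Data.Fin using (Fin; zero; suc; _↑ˡ_; _↑ʳ_; splitAt)
open import Data.Fin.Properties using (_≟_; splitAt⁻¹-↑ˡ; splitAt⁻¹-↑ʳ)
open import Data.Vec.Functional using (_++_)
open import Data.Vec.Functional.Properties using (lookup-++ˡ; lookup-++ʳ)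
open import Data.Product using (Σ; ∃!; _×_; _,_; proj₁)
open import Data.Sum using (inj₁; inj₂)
open import Data.Empty using (⊥-elim)
open import Function using (_∘_)
open import Level using (0ℓ)
open import Relation.Nullary using (yes; no; ¬_)
open import Relation.Unary using (Pred; Decidable)
open import Relation.Binary.Bundles using (Setoid)
open import Relation.Binary.PropositionalEquality
import Relation.Binary.Reasoning.Setoid as SetoidReasoning

↑-ext : ∀ {m n} {A : Set} {f g : Fin (m + n) → A} →
        (∀ k → f (k ↑ˡ n) ≡ g (k ↑ˡ n)) → (∀ o → f (m ↑ʳ o) ≡ g (m ↑ʳ o)) →
        ∀ x → f x ≡ g x
↑-ext {m} {f = f} {g} eqˡ eqʳ x with splitAt m x in split
... | inj₁ k = subst (λ y → f y ≡ g y) (splitAt⁻¹-↑ˡ split) (eqˡ k)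
... | inj₂ o = subst (λ y → f y ≡ g y) (splitAt⁻¹-↑ʳ split) (eqʳ o)

record Enumeration {N : ℕ} (P : Pred (Fin N) 0ℓ) : Set where
  field
    size       : ℕ
    enum       : Fin size → Fin N
    enum-∈     : ∀ k → P (enum k)
    index      : ∀ i → P i → Fin size
    enum-index : ∀ i p → enum (index i p) ≡ i
    index-enum : ∀ k p → index (enum k) p ≡ k

  index-unique : ∀ {k i} p → enum k ≡ i → index i p ≡ k
  index-unique p refl = index-enum _ p

  enum-unique-preimage : ∀ i → P i → ∃! _≡_ λ k → enum k ≡ i
  enum-unique-preimage i p = index i p , enum-index i p , index-unique p

open Enumeration

module _ {N : ℕ} {P : Pred (Fin (suc N)) 0ℓ} where

  extend-∈ : P zero → Enumeration (P ∘ suc) → Enumeration P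
  extend-∈ p₀ E .size = suc (size E)
  extend-∈ p₀ E .enum zero = zero
  extend-∈ p₀ E .enum (suc k) = suc (enum E k)
  extend-∈ p₀ E .enum-∈ zero = p₀
  extend-∈ p₀ E .enum-∈ (suc k) = enum-∈ E k
  extend-∈ p₀ E .index zero p = zero
  extend-∈ p₀ E .index (suc i) p = suc (index E i p)
  extend-∈ p₀ E .enum-index zero p = refl
  extend-∈ p₀ E .enum-index (suc i) p = cong suc (enum-index E i p)
  extend-∈ p₀ E .index-enum zero p = refl
  extend-∈ p₀ E .index-enum (suc k) p = cong suc (index-enum E k p)

  extend-∉ : ¬ P zero → Enumeration (P ∘ suc) → Enumeration P
  extend-∉ ¬p₀ E .size = size E
  extend-∉ ¬p₀ E .enum = suc ∘ enum E
  extend-∉ ¬p₀ E .enum-∈ = enum-∈ E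
  extend-∉ ¬p₀ E .index zero p = ⊥-elim (¬p₀ p)
  extend-∉ ¬p₀ E .index (suc i) p = index E i p
  extend-∉ ¬p₀ E .enum-index zero p = ⊥-elim (¬p₀ p)
  extend-∉ ¬p₀ E .enum-index (suc i) p = cong suc (enum-index E i p)
  extend-∉ ¬p₀ E .index-enum = index-enum E

enumerate : ∀ {N} {P : Pred (Fin N) 0ℓ} → Decidable P → Enumeration P
enumerate {zero} P? = record
  { size = 0 ; enum = λ () ; enum-∈ = λ () ; index = λ ()
  ; enum-index = λ () ; index-enum = λ () }
enumerate {suc N} P? with P? zero
... | yes p₀ = extend-∈ p₀ (enumerate (P? ∘ suc))
... | no ¬p₀ = extend-∉ ¬p₀ (enumerate (P? ∘ suc))

module _ {a : ℕ} {T : Set} {p : Fin a → T} where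

  fiberwise : {B : Set} (E : ∀ t → Enumeration (λ i → p i ≡ t)) →
              (∀ t → Fin (size (E t)) → B) → Fin a → B
  fiberwise E g i = g (p i) (index (E (p i)) i refl)

  module _ {B : Set} (E : ∀ t → Enumeration (λ i → p i ≡ t)) (g : ∀ t → Fin (size (E t)) → B) where

    fiberwise-index : ∀ t i (e : p i ≡ t) → fiberwise E g i ≡ g t (index (E t) i e)
    fiberwise-index _ i refl = refl

    fiberwise-enum : ∀ t k → fiberwise E g (enum (E t) k) ≡ g t k
    fiberwise-enum t k = trans (fiberwise-index t _ (enum-∈ (E t) k))
                               (cong (g t) (index-enum (E t) k _))

    fiberwise-pullback : {T' : Set} {hT : T → T'} {q : B → T'} →
                         (∀ t j → q j ≡ hT t → ∃! _≡_ λ k → g t k ≡ j) →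
                         IsPullback p (fiberwise E g) hT q
    fiberwise-pullback g-unique t j e with g-unique t j e
    ... | k , gk≡j , unique =
      enum (E t) k , (enum-∈ (E t) k , trans (fiberwise-enum t k) gk≡j) ,
      λ {i} (pi≡t , hi≡j) →
        trans (cong (enum (E t)) (unique (trans (sym (fiberwise-index t i pi≡t)) hi≡j)))
              (enum-index (E t) i pi≡t)

module _ {I B T : Set} {g : I → B} {gT : Fin 1 → T} {q : B → T} where

  unique-preimage⇒pullback : (∀ j → q j ≡ gT zero → ∃! _≡_ λ k → g k ≡ j) →
                             IsPullback (λ _ → zero) g gT q
  unique-preimage⇒pullback u zero j e with u j e
  ... | k , gk≡j , unique = k , (refl , gk≡j) , λ (_ , gy≡j) → unique gy≡j

  pullback⇒unique-preimage : IsPullback (λ _ → zero) g gT q →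
                             ∀ j → q j ≡ gT zero → ∃! _≡_ λ k → g k ≡ j
  pullback⇒unique-preimage pb j e with pb zero j e
  ... | k , (_ , gk≡j) , unique = k , gk≡j , λ gy≡j → unique (refl , gy≡j)

corestriction-unique-preimage :
  ∀ {a} {I T : Set} {p : Fin a → T} {t : T} (E : Enumeration (λ i → p i ≡ t))
  {g : I → Fin a} (pg : ∀ k → p (g k) ≡ t) →
  (∀ j → p j ≡ t → ∃! _≡_ λ k → g k ≡ j) →
  ∀ j → ∃! _≡_ λ k → index E (g k) (pg k) ≡ j
corestriction-unique-preimage E pg g-unique j with g-unique (enum E j) (enum-∈ E j)
... | k , gk≡j , unique =
  k , index-unique E (pg k) (sym gk≡j) ,
  λ {y} e → unique (trans (sym (enum-index E _ (pg y))) (cong (enum E) e))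

≈H-refl : ∀ {P Q} {f : Hom P Q} → f ≈H f
≈H-refl = (λ _ → refl) , (λ _ → refl) , (λ _ → refl) , (λ _ → refl)

≈H-sym : ∀ {P Q} {f g : Hom P Q} → f ≈H g → g ≈H f
≈H-sym (s , i , t , o) = sym ∘ s , sym ∘ i , sym ∘ t , sym ∘ o

≈H-trans : ∀ {P Q} {f g h : Hom P Q} → f ≈H g → g ≈H h → f ≈H h
≈H-trans (s , i , t , o) (s' , i' , t' , o') =
  (λ x → trans (s x) (s' x)) , (λ x → trans (i x) (i' x)) ,
  (λ x → trans (t x) (t' x)) , (λ x → trans (o x) (o' x))

Hom-setoid : Petri → Petri → Setoid 0ℓ 0ℓ
Hom-setoid P Q = record
  { Carrier = Hom P Q
  ; _≈_ = _≈H_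
  ; isEquivalence = record
      { refl = λ {f} → ≈H-refl {f = f}
      ; sym = λ {f g} → ≈H-sym {f = f} {g}
      ; trans = λ {f g h} → ≈H-trans {f = f} {g} {h} } }

∘H-congˡ : ∀ {P Q R} {g g' : Hom Q R} → g ≈H g' → (u : Hom P Q) → (g ∘H u) ≈H (g' ∘H u)
∘H-congˡ (s , i , t , o) u = s ∘ fS u , i ∘ fI u , t ∘ fT u , o ∘ fO u

∘H-congʳ : ∀ {P Q R} (h : Hom Q R) {f f' : Hom P Q} → f ≈H f' → (h ∘H f) ≈H (h ∘H f')
∘H-congʳ h (s , i , t , o) =
  cong (fS h) ∘ s , cong (fI h) ∘ i , cong (fT h) ∘ t , cong (fO h) ∘ o

point : (P : Petri) → Fin (nS P) → Hom (el unitG) P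
point P s = record
  { fS = λ _ → s ; fI = λ () ; fT = λ () ; fO = λ ()
  ; comm-iS = λ () ; comm-iT = λ () ; comm-oT = λ () ; comm-oS = λ ()
  ; pb-I = λ () ; pb-O = λ () }

point-∘ : ∀ {P Q} (f : Hom P Q) (x : Fin (nS P)) → point Q (fS f x) ≈H (f ∘H point P x)
point-∘ f x = (λ _ → refl) , (λ ()) , (λ ()) , (λ ())

corolla-hom-ext : ∀ {m n P} (f g : Hom (el (corolla m n)) P) →
                  (∀ k → fI f k ≡ fI g k) → (∀ x → fT f x ≡ fT g x) →
                  (∀ o → fO f o ≡ fO g o) → f ≈H g
corolla-hom-ext {m} {n} {P} f g eqI eqT eqO = ↑-ext on-inputs on-outputs , eqI , eqT , eqO
  where
    open ≡-Reasoning
    on-inputs : ∀ k → fS f (k ↑ˡ n) ≡ fS g (k ↑ˡ n)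
    on-inputs k = begin
      fS f (k ↑ˡ n)   ≡⟨ comm-iS f k ⟩
      iS P (fI f k)   ≡⟨ cong (iS P) (eqI k) ⟩
      iS P (fI g k)   ≡⟨ comm-iS g k ⟨
      fS g (k ↑ˡ n)   ∎
    on-outputs : ∀ o → fS f (m ↑ʳ o) ≡ fS g (m ↑ʳ o)
    on-outputs o = begin
      fS f (m ↑ʳ o)   ≡⟨ comm-oS f o ⟩
      oS P (fO f o)   ≡⟨ cong (oS P) (eqO o) ⟩
      oS P (fO g o)   ≡⟨ comm-oS g o ⟨
      fS g (m ↑ʳ o)   ∎

module _ (P : Petri) where

  inputs : (t : Fin (nT P)) → Enumeration (λ i → iT P i ≡ t)
  inputs t = enumerate (λ i → iT P i ≟ t)

  outputs : (t : Fin (nT P)) → Enumeration (λ o → oT P o ≡ t)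
  outputs t = enumerate (λ o → oT P o ≟ t)

  corolla-of : Fin (nT P) → ElGr
  corolla-of t = corolla (size (inputs t)) (size (outputs t))

  star : (t : Fin (nT P)) → Hom (el (corolla-of t)) P
  star t = record
    { fS = (iS P ∘ enum ins) ++ (oS P ∘ enum outs)
    ; fI = enum ins ; fT = λ _ → t ; fO = enum outs
    ; comm-iS = lookup-++ˡ (iS P ∘ enum ins) (oS P ∘ enum outs)
    ; comm-iT = sym ∘ enum-∈ ins
    ; comm-oT = sym ∘ enum-∈ outs
    ; comm-oS = lookup-++ʳ (iS P ∘ enum ins) (oS P ∘ enum outs)
    ; pb-I = unique-preimage⇒pullback (enum-unique-preimage ins)
    ; pb-O = unique-preimage⇒pullback (enum-unique-preimage outs) }
    where
      ins : Enumeration (λ i → iT P i ≡ t)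
      ins = inputs t
      outs : Enumeration (λ o → oT P o ≡ t)
      outs = outputs t

  input-position : (i : Fin (nI P)) → Fin (size (inputs (iT P i)))
  input-position i = index (inputs (iT P i)) i refl

  output-position : (o : Fin (nO P)) → Fin (size (outputs (oT P o)))
  output-position o = index (outputs (oT P o)) o refl

  star-input-position : ∀ i → fI (star (iT P i)) (input-position i) ≡ i
  star-input-position i = enum-index (inputs (iT P i)) i refl

  star-output-position : ∀ o → fO (star (oT P o)) (output-position o) ≡ o
  star-output-position o = enum-index (outputs (oT P o)) o refl

module _ {m n : ℕ} {P : Petri} (f : Hom (el (corolla m n)) P) where

  private
    t : Fin (nT P)
    t = fT f zero
    ins : Enumeration (λ i → iT P i ≡ t)
    ins = inputs P t
    outs : Enumeration (λ o → oT P o ≡ t)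
    outs = outputs P t

    f-input : ∀ k → iT P (fI f k) ≡ t
    f-input k = sym (comm-iT f k)

    f-output : ∀ o → oT P (fO f o) ≡ t
    f-output o = sym (comm-oT f o)

    uI : Fin m → Fin (size ins)
    uI k = index ins (fI f k) (f-input k)

    uO : Fin n → Fin (size outs)
    uO o = index outs (fO f o) (f-output o)

  factor-through-star : Hom (el (corolla m n)) (el (corolla-of P t))
  factor-through-star = record
    { fS = ((_↑ˡ size outs) ∘ uI) ++ ((size ins ↑ʳ_) ∘ uO)
    ; fI = uI ; fT = λ _ → zero ; fO = uO
    ; comm-iS = lookup-++ˡ ((_↑ˡ size outs) ∘ uI) ((size ins ↑ʳ_) ∘ uO)
    ; comm-iT = λ _ → refl
    ; comm-oT = λ _ → refl
    ; comm-oS = lookup-++ʳ ((_↑ˡ size outs) ∘ uI) ((size ins ↑ʳ_) ∘ uO)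
    ; pb-I = unique-preimage⇒pullback λ j _ →
        corestriction-unique-preimage ins f-input (pullback⇒unique-preimage (pb-I f)) j
    ; pb-O = unique-preimage⇒pullback λ j _ →
        corestriction-unique-preimage outs f-output (pullback⇒unique-preimage (pb-O f)) j }

  star-factorisation : f ≈H (star P t ∘H factor-through-star)
  star-factorisation = corolla-hom-ext f (star P t ∘H factor-through-star)
    (λ k → sym (enum-index ins (fI f k) (f-input k)))
    (λ { zero → refl })
    (λ o → sym (enum-index outs (fO f o) (f-output o)))

restricted-Yoneda-faithful : ∀ {P Q} (h h' : Hom P Q) →
  (∀ (E : ElGr) (f : Hom (el E) P) → (h ∘H f) ≈H (h' ∘H f)) → h ≈H h'
restricted-Yoneda-faithful {P} h h' agree = on-places , on-inputs , on-transitions , on-outputs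
  where
    on-places : ∀ s → fS h s ≡ fS h' s
    on-places s = let (eqS , _) = agree unitG (point P s) in eqS zero
    on-transitions : ∀ t → fT h t ≡ fT h' t
    on-transitions t = let (_ , _ , eqT , _) = agree (corolla-of P t) (star P t) in eqT zero
    on-inputs : ∀ i → fI h i ≡ fI h' i
    on-inputs i = let (_ , eqI , _) = agree (corolla-of P (iT P i)) (star P (iT P i)) in
      subst (λ x → fI h x ≡ fI h' x) (star-input-position P i) (eqI (input-position P i))
    on-outputs : ∀ o → fO h o ≡ fO h' o
    on-outputs o = let (_ , _ , _ , eqO) = agree (corolla-of P (oT P o)) (star P (oT P o)) in
      subst (λ x → fO h x ≡ fO h' x) (star-output-position P o) (eqO (output-position P o))

module RestrictedYonedaFull {P Q : Petri} (η : NatTrans P Q) where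

  η-star : (t : Fin (nT P)) → Hom (el (corolla-of P t)) Q
  η-star t = α η (corolla-of P t) (star P t)

  hS : Fin (nS P) → Fin (nS Q)
  hS s = fS (α η unitG (point P s)) zero

  hT : Fin (nT P) → Fin (nT Q)
  hT t = fT (η-star t) zero

  hI : Fin (nI P) → Fin (nI Q)
  hI = fiberwise (inputs P) (fI ∘ η-star)

  hO : Fin (nO P) → Fin (nO Q)
  hO = fiberwise (outputs P) (fO ∘ η-star)

  α-places : ∀ E (f : Hom (el E) P) x → fS (α η E f) x ≡ hS (fS f x)
  α-places E f x = sym (begin
    fS (α η unitG (point P (fS f x))) zero  ≡⟨ proj₁ (α-resp η unitG (point-∘ f x)) zero ⟩
    fS (α η unitG (f ∘H point _ x)) zero    ≡⟨ proj₁ (natural η E unitG (point _ x) f) zero ⟩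
    fS (α η E f) x                          ∎)
    where open ≡-Reasoning

  h-comm-iS : ∀ i → hS (iS P i) ≡ iS Q (hI i)
  h-comm-iS i = begin
    hS (iS P i)             ≡⟨ cong (hS ∘ iS P) (star-input-position P i) ⟨
    hS (iS P (fI c k))      ≡⟨ cong hS (comm-iS c k) ⟨
    hS (fS c (k ↑ˡ _))      ≡⟨ α-places _ c (k ↑ˡ _) ⟨
    fS (η-star t) (k ↑ˡ _)  ≡⟨ comm-iS (η-star t) k ⟩
    iS Q (hI i)             ∎
    where
      open ≡-Reasoning
      t : Fin (nT P)
      t = iT P i
      c : Hom (el (corolla-of P t)) P
      c = star P t
      k : Fin (size (inputs P t))
      k = input-position P i

  h-comm-oS : ∀ o → hS (oS P o) ≡ oS Q (hO o)
  h-comm-oS o = begin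
    hS (oS P o)             ≡⟨ cong (hS ∘ oS P) (star-output-position P o) ⟨
    hS (oS P (fO c k))      ≡⟨ cong hS (comm-oS c k) ⟨
    hS (fS c (_ ↑ʳ k))      ≡⟨ α-places _ c (_ ↑ʳ k) ⟨
    fS (η-star t) (_ ↑ʳ k)  ≡⟨ comm-oS (η-star t) k ⟩
    oS Q (hO o)             ∎
    where
      open ≡-Reasoning
      t : Fin (nT P)
      t = oT P o
      c : Hom (el (corolla-of P t)) P
      c = star P t
      k : Fin (size (outputs P t))
      k = output-position P o

  h : Hom P Q
  h = record
    { fS = hS ; fI = hI ; fT = hT ; fO = hO
    ; comm-iS = h-comm-iS
    ; comm-iT = λ i → comm-iT (η-star (iT P i)) (input-position P i)
    ; comm-oT = λ o → comm-oT (η-star (oT P o)) (output-position P o)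
    ; comm-oS = h-comm-oS
    ; pb-I = fiberwise-pullback (inputs P) (fI ∘ η-star)
               (λ t → pullback⇒unique-preimage (pb-I (η-star t)))
    ; pb-O = fiberwise-pullback (outputs P) (fO ∘ η-star)
               (λ t → pullback⇒unique-preimage (pb-O (η-star t))) }

  η-star≈h∘star : ∀ t → η-star t ≈H (h ∘H star P t)
  η-star≈h∘star t =
    α-places _ (star P t) ,
    (λ k → sym (fiberwise-enum (inputs P) (fI ∘ η-star) t k)) ,
    (λ { zero → refl }) ,
    (λ k → sym (fiberwise-enum (outputs P) (fO ∘ η-star) t k))

  α≈h∘ : ∀ (E : ElGr) (f : Hom (el E) P) → α η E f ≈H (h ∘H f)
  α≈h∘ unitG f = α-places unitG f , (λ ()) , (λ ()) , (λ ())
  -- ≈H only compares components, on which ∘H is strictly associative.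
  α≈h∘ (corolla m n) f = begin
    α η E f                  ≈⟨ α-resp η E (star-factorisation f) ⟩
    α η E (star P t ∘H u)    ≈⟨ natural η (corolla-of P t) E u (star P t) ⟩
    η-star t ∘H u            ≈⟨ ∘H-congˡ {g = η-star t} {h ∘H star P t} (η-star≈h∘star t) u ⟩
    h ∘H (star P t ∘H u)     ≈⟨ ∘H-congʳ h {f} {star P t ∘H u} (star-factorisation f) ⟨
    h ∘H f                   ∎
    where
      open SetoidReasoning (Hom-setoid (el (corolla m n)) Q)
      E : ElGr
      E = corolla m n
      t : Fin (nT P)
      t = fT f zero
      u : Hom (el E) (el (corolla-of P t))
      u = factor-through-star f

lemma5p2 : (∀ (P Q : Petri) (h h' : Hom P Q) →
               (∀ (E : ElGr) (f : Hom (el E) P) → (h ∘H f) ≈H (h' ∘H f)) → h ≈H h')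
             × (∀ (P Q : Petri) (η : NatTrans P Q) →
               Σ (Hom P Q) λ h → ∀ (E : ElGr) (f : Hom (el E) P) → α η E f ≈H (h ∘H f))
lemma5p2 = (λ _ _ → restricted-Yoneda-faithful) ,
           (λ _ _ η → RestrictedYonedaFull.h η , RestrictedYonedaFull.α≈h∘ η)
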